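{- Let $(A,\le,\bullet,i,\multimap)$ be a poset with a residuated commutative pomonoid and all binary meets, let $k\in A$, and let $(\lhd,j)$ be a pomonoid on $(A,\le)$ such that $(\bullet,i)$ is duoidal over $(\lhd,j)$, $k\lhd k\le k$, and $j\le k$. Then $x\lhd y=(x^+\lhd y^+,x^-\lhd y^-)$ and $J=(j,j)$ form a pomonoid on $\mathrm{Chu}(A,k)$ that is self-dual, i.e. $\neg(x\lhd y)=\neg x\lhd\neg y$ where $\neg(a^+,a^-)=(a^-,a^+)$.
   Context: A pomonoid is a monoid on a poset with monotone operation; a commutative pomonoid $(\bullet,i)$ is residuated if $x\bullet y\le z$ iff $x\le y\multimap z$. $(\bullet,i)$ is duoidal over $(\lhd,j)$ if $(w\lhd x)\bullet(y\lhd z)\le(w\bullet y)\lhd(x\bullet z)$, $j\bullet j\le j$, $i\le i\lhd i$, $i\le j$. $\mathrm{Chu}(A,k)$ is the poset of pairs $(a^+,a^-)\in A^2$ with $a^+\bullet a^-\le k$, ordered by $(a^+,a^-)\sqsubseteq(b^+,b^-)$ iff $a^+\le b^+$ and $b^-\le a^-$. -}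

module Defs where

open import Level using (Level; _⊔_; suc)
open import Data.Product using (_×_; _,_; proj₁; proj₂)
open import Relation.Binary.PropositionalEquality using (_≡_)
open import Relation.Binary.Structures using (IsPartialOrder)

record IsPomonoid {a ℓ} {C : Set a} (_≤_ : C → C → Set ℓ)
                  (_⊗_ : C → C → C) (e : C) : Set (a ⊔ ℓ) where
  field
    assoc     : ∀ x y z → (x ⊗ y) ⊗ z ≡ x ⊗ (y ⊗ z)
    identityˡ : ∀ x → e ⊗ x ≡ x
    identityʳ : ∀ x → x ⊗ e ≡ x
    mono      : ∀ {x x′ y y′} → x ≤ x′ → y ≤ y′ → (x ⊗ y) ≤ (x′ ⊗ y′)

record IsPomonoidOn {a ℓ p} {C : Set a} (P : C → Set p) (_≤_ : C → C → Set ℓ)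
                    (_⊗_ : C → C → C) (e : C) : Set (a ⊔ ℓ ⊔ p) where
  field
    closed    : ∀ {x y} → P x → P y → P (x ⊗ y)
    unit∈     : P e
    assoc     : ∀ {x y z} → P x → P y → P z → (x ⊗ y) ⊗ z ≡ x ⊗ (y ⊗ z)
    identityˡ : ∀ {x} → P x → e ⊗ x ≡ x
    identityʳ : ∀ {x} → P x → x ⊗ e ≡ x
    mono      : ∀ {x x′ y y′} → P x → P x′ → P y → P y′ →
                x ≤ x′ → y ≤ y′ → (x ⊗ y) ≤ (x′ ⊗ y′)

record ResiduatedPoset a ℓ : Set (suc (a ⊔ ℓ)) where
  infixr 5 _⊸_
  infixl 7 _•_
  field
    A              : Set a
    _≤_            : A → A → Set ℓ
    isPartialOrder : IsPartialOrder _≡_ _≤_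
    _•_            : A → A → A
    i              : A
    _⊸_            : A → A → A
    _∧_            : A → A → A
    •-isPomonoid   : IsPomonoid _≤_ _•_ i
    •-comm         : ∀ x y → x • y ≡ y • x
    residual⇒      : ∀ {x y z} → (x • y) ≤ z → x ≤ (y ⊸ z)
    residual⇐      : ∀ {x y z} → x ≤ (y ⊸ z) → (x • y) ≤ z
    ∧-lowerˡ       : ∀ x y → (x ∧ y) ≤ x
    ∧-lowerʳ       : ∀ x y → (x ∧ y) ≤ y
    ∧-greatest     : ∀ {x y z} → z ≤ x → z ≤ y → z ≤ (x ∧ y)

module _ {a ℓ} (R : ResiduatedPoset a ℓ) where
  open ResiduatedPoset R

  record IsDuoidalOver (_◁_ : A → A → A) (j : A) : Set (a ⊔ ℓ) where
    field
      interchange : ∀ w x y z → ((w ◁ x) • (y ◁ z)) ≤ ((w • y) ◁ (x • z))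
      j•j≤j       : (j • j) ≤ j
      i≤i◁i       : i ≤ (i ◁ i)
      i≤j         : i ≤ j

  InChu : A → A × A → Set ℓ
  InChu k (p , m) = (p • m) ≤ k

  _⊑_ : A × A → A × A → Set ℓ
  (p , m) ⊑ (p′ , m′) = (p ≤ p′) × (m′ ≤ m)

  lift : (A → A → A) → A × A → A × A → A × A
  lift _◁_ (p , m) (p′ , m′) = (p ◁ p′) , (m ◁ m′)

  chuNeg : A × A → A × A
  chuNeg (p , m) = m , p

{-# OPTIONS --safe #-}
-- The pointwise structure (A × A, ⊑, lift ◁, (j , j)) is a pomonoid because (A, ≤, ◁, j)
-- is one (the order on the second component is reversed, which monotonicity does not see).
-- Chu(A,k) is closed under it: by the interchange law
-- (x⁺ ◁ y⁺) • (x⁻ ◁ y⁻) ≤ (x⁺ • x⁻) ◁ (y⁺ • y⁻) ≤ k ◁ k ≤ k, and j • j ≤ j ≤ k.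
module Submission where

open import Defs
open import Data.Product using (_×_; _,_)
open import Relation.Binary.PropositionalEquality using (_≡_; refl; cong₂)
open import Relation.Binary.Structures using (IsPartialOrder)

restrict-isPomonoid : ∀ {a ℓ p} {C : Set a} {P : C → Set p} {_≤_ : C → C → Set ℓ}
                      {_⊗_ : C → C → C} {e : C} →
                      IsPomonoid _≤_ _⊗_ e →
                      (∀ {x y} → P x → P y → P (x ⊗ y)) → P e →
                      IsPomonoidOn P _≤_ _⊗_ e
restrict-isPomonoid M closed e∈P = record
  { closed    = closed
  ; unit∈     = e∈P
  ; assoc     = λ {x} {y} {z} _ _ _ → assoc x y z
  ; identityˡ = λ {x} _ → identityˡ x
  ; identityʳ = λ {x} _ → identityʳ x
  ; mono      = λ _ _ _ _ → mono
  }
  where open IsPomonoid M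

module _ {a ℓ} (R : ResiduatedPoset a ℓ) where
  open ResiduatedPoset R
  open IsPartialOrder isPartialOrder using (trans)

  module _ {_◁_ : A → A → A} {j : A} (◁-isPomonoid : IsPomonoid _≤_ _◁_ j) where
    open IsPomonoid ◁-isPomonoid

    lift-isPomonoid : IsPomonoid (_⊑_ R) (lift R _◁_) (j , j)
    lift-isPomonoid = record
      { assoc     = λ { (p , m) (p′ , m′) (p″ , m″) →
                        cong₂ _,_ (assoc p p′ p″) (assoc m m′ m″) }
      ; identityˡ = λ { (p , m) → cong₂ _,_ (identityˡ p) (identityˡ m) }
      ; identityʳ = λ { (p , m) → cong₂ _,_ (identityʳ p) (identityʳ m) }
      ; mono      = λ { {p , m} {p′ , m′} {q , n} {q′ , n′} (p≤p′ , m′≤m) (q≤q′ , n′≤n) →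
                        mono p≤p′ q≤q′ , mono m′≤m n′≤n }
      }

    lift-closed-InChu : IsDuoidalOver R _◁_ j → ∀ {k} → (k ◁ k) ≤ k →
                        ∀ {x y} → InChu R k x → InChu R k y → InChu R k (lift R _◁_ x y)
    lift-closed-InChu D k◁k≤k {p , m} {p′ , m′} x∈Chu y∈Chu =
      trans (interchange p p′ m m′) (trans (mono x∈Chu y∈Chu) k◁k≤k)
      where open IsDuoidalOver D

  unit-InChu : ∀ {_◁_ j k} → IsDuoidalOver R _◁_ j → j ≤ k → InChu R k (j , j)
  unit-InChu D j≤k = trans j•j≤j j≤k
    where open IsDuoidalOver D

  chuNeg-lift : ∀ _◁_ x y → chuNeg R (lift R _◁_ x y) ≡ lift R _◁_ (chuNeg R x) (chuNeg R y)
  chuNeg-lift _◁_ (p , m) (p′ , m′) = refl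

proposition3p43 : ∀ {a ℓ} (R : ResiduatedPoset a ℓ) →
    let open ResiduatedPoset R in
    (k : A) (_◁_ : A → A → A) (j : A) →
    IsPomonoid _≤_ _◁_ j →
    IsDuoidalOver R _◁_ j →
    (k ◁ k) ≤ k →
    j ≤ k →
    IsPomonoidOn (InChu R k) (_⊑_ R) (lift R _◁_) (j , j)
      × (∀ {x y} → InChu R k x → InChu R k y →
           chuNeg R (lift R _◁_ x y) ≡ lift R _◁_ (chuNeg R x) (chuNeg R y))
proposition3p43 R k _◁_ j ◁-isPomonoid D k◁k≤k j≤k =
    restrict-isPomonoid (lift-isPomonoid R ◁-isPomonoid)
                        (lift-closed-InChu R ◁-isPomonoid D k◁k≤k)
                        (unit-InChu R D j≤k)
  , λ {x} {y} _ _ → chuNeg-lift R _◁_ x y
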